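{- Let $G$ be an $n$-vertex graph with VC-dimension $1$. Then $h(G)\le \max\{\frac{n}{\alpha(G)},3\}$. In particular, if $\alpha(G)=cn$ for a positive constant $c\neq \frac{2}{5}$, then $h(G)\le \lfloor \frac1c\rfloor$; and if $\alpha(G)=\frac{2n}{5}$, then $h(G)\le 3$.
   Context: For a set system $\mathcal{F}$ on ground set $X$, its VC-dimension is the largest $d$ such that some $S\subseteq X$ with $|S|=d$ satisfies: for every $B\subseteq S$ there is $A\in\mathcal{F}$ with $A\cap S=B$. The VC-dimension of a graph $G$ is that of $\{N_G(v):v\in V(G)\}$. $\alpha(G)$ is the independence number. A hitting set of $G$ is a set $T\subseteq V(G)$ meeting every maximum independent set of $G$; $h(G)$ is the minimum size of a hitting set. -}

module Defs where

open import Data.Nat using (ℕ; _≤_)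
open import Data.Bool using (Bool; true; false)
open import Data.Fin using (Fin)
open import Data.Fin.Subset using (Subset; _∈_; _⊆_; _∩_; ∣_∣; Nonempty)
open import Data.Vec using (tabulate)
open import Data.Product using (Σ; ∃; _×_)
open import Relation.Binary.PropositionalEquality using (_≡_)

record Graph (n : ℕ) : Set where
  field
    adj   : Fin n → Fin n → Bool
    sym   : ∀ u v → adj u v ≡ adj v u
    irrefl : ∀ v → adj v v ≡ false

open Graph public

N : ∀ {n} → Graph n → Fin n → Subset n
N G v = tabulate (adj G v)

Shattered : ∀ {n} → Graph n → Subset n → Set
Shattered {n} G S = ∀ (B : Subset n) → B ⊆ S → ∃ λ v → N G v ∩ S ≡ B

HasVCdim : ∀ {n} → Graph n → ℕ → Set
HasVCdim {n} G d =
  (Σ (Subset n) λ S → Shattered G S × ∣ S ∣ ≡ d)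
  × (∀ (S : Subset n) → Shattered G S → ∣ S ∣ ≤ d)

Independent : ∀ {n} → Graph n → Subset n → Set
Independent G S = ∀ u v → u ∈ S → v ∈ S → adj G u v ≡ false

IsIndependenceNumber : ∀ {n} → Graph n → ℕ → Set
IsIndependenceNumber {n} G a =
  (Σ (Subset n) λ S → Independent G S × ∣ S ∣ ≡ a)
  × (∀ (S : Subset n) → Independent G S → ∣ S ∣ ≤ a)

IsMaxIndependent : ∀ {n} → Graph n → ℕ → Subset n → Set
IsMaxIndependent G a S = Independent G S × ∣ S ∣ ≡ a

IsHittingSet : ∀ {n} → Graph n → ℕ → Subset n → Set
IsHittingSet {n} G a T = ∀ (S : Subset n) → IsMaxIndependent G a S → Nonempty (T ∩ S)

IsHittingNumber : ∀ {n} → Graph n → ℕ → ℕ → Set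
IsHittingNumber {n} G a h =
  (Σ (Subset n) λ T → IsHittingSet G a T × ∣ T ∣ ≡ h)
  × (∀ (T : Subset n) → IsHittingSet G a T → h ≤ ∣ T ∣)

{-# OPTIONS --safe #-}
module Submission where

-- With VC-dimension 1, no pair {x, y} is shattered by neighbourhoods. So if an edge xy has a common
-- neighbour, every vertex is adjacent to x or to y. If G contains a triangle, any two vertices then
-- have a common neighbour, non-adjacency is transitive and G is complete multipartite: the maximum
-- independent sets are the parts of size α, there are at most n / α of them, and one vertex from
-- each is a hitting set. If G is triangle-free, let u have minimum degree and w be a neighbour of u.
-- Two neighbours of w have nested neighbourhoods, so an independent set avoiding u and w extends
-- by u or by w. Hence {u, w} meets every maximum independent set (h ≤ 2), and deleting u and w
-- lowers α by one; by induction, when no vertex lies in every maximum independent set (h ≥ 2),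
-- 2α ≤ n. In both cases h α ≤ n, and the bounds of the theorem are arithmetic consequences.

open import Defs
open import Data.Nat using (ℕ; _≤_; _*_)
open import Data.Sum using (_⊎_)
open import Data.Product using (_×_)
open import Relation.Binary.PropositionalEquality using (_≡_; _≢_)

open import Data.Bool using (true; false; _≟_)
open import Data.Bool.Properties using (not-¬; ¬-not)
open import Data.Empty using (⊥-elim)
open import Data.Fin using (Fin)
open import Data.Fin.Properties using (any?)
open import Data.Fin.Subset
  using (Subset; _∈_; _∉_; _⊆_; _∩_; _∪_; _─_; _-_; ⁅_⁆; ∁; ⊥; ⊤; ∣_∣; Nonempty)
open import Data.Fin.Subset.Properties
  using ( _∈?_; nonempty?; Empty-unique; ∉⊥; ∈⊤; ∣⊥∣≡0; ∣⊤∣≡n; ∣p∣≤n; ∣⁅x⁆∣≡1; x∈⁅x⁆; x∈⁅y⁆⇒x≡y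
        ; x≢y⇒x∉⁅y⁆; ⊆-antisym; ⊆-trans; p⊆q⇒∣p∣≤∣q∣; p⊂q⇒∣p∣<∣q∣; x∈p∩q⁺; x∈p∩q⁻; p∩q⊆q
        ; ∣p∩q∣≤∣q∣; p⊆p∪q; q⊆p∪q; x∈p∪q⁺; x∈p∪q⁻; x∈p∧x∉q⇒x∈p─q; p─q⊆p
        ; p∩q≢∅⇒∣p─q∣<∣p∣; x∈p∧x≢y⇒x∈p-y; x∈p⇒∣p-x∣<∣p∣; x∉p⇒x∈∁p; x∈∁p⇒x∉p )
open import Data.List using (allFin; filter)
open import Data.List.Extrema.Nat using (argmin; argmin-all; f[argmin]≤f[xs])
open import Data.List.Membership.Propositional.Properties using (∈-filter⁺; ∈-allFin)
open import Data.List.Relation.Unary.All as All using ()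
open import Data.List.Relation.Unary.All.Properties using (all-filter)
open import Data.Nat using (suc; zero; _+_; _<_; z≤n; s≤s; z<s; _≤?_; >-nonZero) renaming (_≟_ to _≟ℕ_)
open import Data.Nat.Properties
  using ( ≤-reflexive; ≤-trans; ≤-antisym; ≤-pred; <⇒≱; <-irrefl; n≤1+n
        ; +-comm; +-suc; +-mono-≤; +-monoʳ-≤; *-suc; *-assoc; *-identityˡ
        ; *-distribʳ-+; *-monoˡ-≤; *-monoʳ-≤; *-cancelʳ-≤; *-cancelˡ-≤; module ≤-Reasoning )
open import Data.Product using (∃; _,_; proj₁; proj₂; map₂; swap)
open import Data.Sum using (inj₁; inj₂; [_,_])
open import Data.Vec using (_∷_; []; lookup; there)
open import Data.Vec.Properties using (lookup∘tabulate; []=⇒lookup; lookup⇒[]=)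
open import Function using (_∘_; id)
open import Relation.Nullary using (¬_; Dec; yes; no)
open import Relation.Nullary.Decidable using (_×-dec_)
open import Relation.Binary.PropositionalEquality as ≡ using (refl; trans; cong; cong₂; subst)

∣p∣≡∣p─q∣+∣p∩q∣ : ∀ {n} (p q : Subset n) → ∣ p ∣ ≡ ∣ p ─ q ∣ + ∣ p ∩ q ∣
∣p∣≡∣p─q∣+∣p∩q∣ []          []          = refl
∣p∣≡∣p─q∣+∣p∩q∣ (true  ∷ p) (true  ∷ q) =
  trans (cong suc (∣p∣≡∣p─q∣+∣p∩q∣ p q)) (≡.sym (+-suc ∣ p ─ q ∣ ∣ p ∩ q ∣))
∣p∣≡∣p─q∣+∣p∩q∣ (true  ∷ p) (false ∷ q) = cong suc (∣p∣≡∣p─q∣+∣p∩q∣ p q)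
∣p∣≡∣p─q∣+∣p∩q∣ (false ∷ p) (true  ∷ q) = ∣p∣≡∣p─q∣+∣p∩q∣ p q
∣p∣≡∣p─q∣+∣p∩q∣ (false ∷ p) (false ∷ q) = ∣p∣≡∣p─q∣+∣p∩q∣ p q

∣p∪q∣≤∣p∣+∣q∣ : ∀ {n} (p q : Subset n) → ∣ p ∪ q ∣ ≤ ∣ p ∣ + ∣ q ∣
∣p∪q∣≤∣p∣+∣q∣ []          []          = z≤n
∣p∪q∣≤∣p∣+∣q∣ (true  ∷ p) (true  ∷ q) =
  s≤s (≤-trans (∣p∪q∣≤∣p∣+∣q∣ p q) (+-monoʳ-≤ ∣ p ∣ (n≤1+n ∣ q ∣)))
∣p∪q∣≤∣p∣+∣q∣ (true  ∷ p) (false ∷ q) = s≤s (∣p∪q∣≤∣p∣+∣q∣ p q)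
∣p∪q∣≤∣p∣+∣q∣ (false ∷ p) (true  ∷ q) =
  subst (suc ∣ p ∪ q ∣ ≤_) (≡.sym (+-suc ∣ p ∣ ∣ q ∣)) (s≤s (∣p∪q∣≤∣p∣+∣q∣ p q))
∣p∪q∣≤∣p∣+∣q∣ (false ∷ p) (false ∷ q) = ∣p∪q∣≤∣p∣+∣q∣ p q

x∈p─q⇒x∉q : ∀ {n} {x : Fin n} (p q : Subset n) → x ∈ p ─ q → x ∉ q
x∈p─q⇒x∉q (_ ∷ p) (_ ∷ q) (there x∈p─q) (there x∈q) = x∈p─q⇒x∉q p q x∈p─q x∈q

module _ {n : ℕ} where

  private
    variable
      p q : Subset n
      x y : Fin n

  x∈p-y⇒x≢y : x ∈ p - y → x ≢ y
  x∈p-y⇒x≢y {p = p} x∈p-y refl = x∈p─q⇒x∉q p ⁅ _ ⁆ x∈p-y (x∈⁅x⁆ _)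

  p⊆q⇒p-x⊆q-x : p ⊆ q → p - x ⊆ q - x
  p⊆q⇒p-x⊆q-x {p = p} {x = x} p⊆q y∈p-x =
    x∈p∧x≢y⇒x∈p-y (p⊆q (p─q⊆p p ⁅ x ⁆ y∈p-x)) (x∈p-y⇒x≢y y∈p-x)

  q⊆p⇒∣p∣≡∣p─q∣+∣q∣ : q ⊆ p → ∣ p ∣ ≡ ∣ p ─ q ∣ + ∣ q ∣
  q⊆p⇒∣p∣≡∣p─q∣+∣q∣ {q} {p} q⊆p =
    trans (∣p∣≡∣p─q∣+∣p∩q∣ p q) (cong (λ r → ∣ p ─ q ∣ + ∣ r ∣) p∩q≡q)
    where
    p∩q≡q : p ∩ q ≡ q
    p∩q≡q = ⊆-antisym (p∩q⊆q p q) (λ x∈q → x∈p∩q⁺ (q⊆p x∈q , x∈q))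

  ∣p∣≤1+∣p-x∣ : ∀ (p : Subset n) x → ∣ p ∣ ≤ suc ∣ p - x ∣
  ∣p∣≤1+∣p-x∣ p x = begin
    ∣ p ∣                     ≡⟨ ∣p∣≡∣p─q∣+∣p∩q∣ p ⁅ x ⁆ ⟩
    ∣ p - x ∣ + ∣ p ∩ ⁅ x ⁆ ∣  ≤⟨ +-monoʳ-≤ ∣ p - x ∣ (∣p∩q∣≤∣q∣ p ⁅ x ⁆) ⟩
    ∣ p - x ∣ + ∣ ⁅ x ⁆ ∣      ≡⟨ cong (∣ p - x ∣ +_) (∣⁅x⁆∣≡1 x) ⟩
    ∣ p - x ∣ + 1             ≡⟨ +-comm ∣ p - x ∣ 1 ⟩
    suc ∣ p - x ∣             ∎
    where open ≤-Reasoning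

  x∈p⇒∣p∣≡1+∣p-x∣ : x ∈ p → ∣ p ∣ ≡ suc ∣ p - x ∣
  x∈p⇒∣p∣≡1+∣p-x∣ {x = x} {p = p} x∈p = ≤-antisym (∣p∣≤1+∣p-x∣ p x) (x∈p⇒∣p-x∣<∣p∣ x∈p)

  x∉p⇒∣p∣≤∣p-x∣ : x ∉ p → ∣ p ∣ ≤ ∣ p - x ∣
  x∉p⇒∣p∣≤∣p-x∣ {x} {p} x∉p =
    p⊆q⇒∣p∣≤∣q∣ {p = p} {q = p - x} (λ y∈p → x∈p∧x≢y⇒x∈p-y y∈p λ { refl → x∉p y∈p })

  ∣p∣≤1+∣p-x-y∣ : (x ∈ p → y ∉ p) → ∣ p ∣ ≤ suc ∣ p - x - y ∣
  ∣p∣≤1+∣p-x-y∣ {x} {p} {y} x∈p⇒y∉p with x ∈? p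
  ... | yes x∈p = begin
    ∣ p ∣              ≡⟨ x∈p⇒∣p∣≡1+∣p-x∣ x∈p ⟩
    suc ∣ p - x ∣      ≤⟨ s≤s (x∉p⇒∣p∣≤∣p-x∣ (x∈p⇒y∉p x∈p ∘ p─q⊆p p ⁅ x ⁆)) ⟩
    suc ∣ p - x - y ∣  ∎
    where open ≤-Reasoning
  ... | no x∉p = ≤-trans (x∉p⇒∣p∣≤∣p-x∣ x∉p) (∣p∣≤1+∣p-x∣ (p - x) y)

  0<∣p∣⇒Nonempty : 0 < ∣ p ∣ → Nonempty p
  0<∣p∣⇒Nonempty {p} 0<∣p∣ with nonempty? p
  ... | yes p≢∅ = p≢∅
  ... | no p≡∅ = ⊥-elim (<⇒≱ 0<∣p∣ (≤-reflexive (trans (cong ∣_∣ (Empty-unique p≡∅)) (∣⊥∣≡0 n))))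

  p⊆q∧∣q∣≤∣p∣⇒q⊆p : p ⊆ q → ∣ q ∣ ≤ ∣ p ∣ → q ⊆ p
  p⊆q∧∣q∣≤∣p∣⇒q⊆p {p} p⊆q ∣q∣≤∣p∣ {x} x∈q with x ∈? p
  ... | yes x∈p = x∈p
  ... | no x∉p = ⊥-elim (<⇒≱ (p⊂q⇒∣p∣<∣q∣ (p⊆q , x , x∈q , x∉p)) ∣q∣≤∣p∣)

  x≢y⇒1<∣⁅x⁆∪⁅y⁆∣ : x ≢ y → 1 < ∣ ⁅ x ⁆ ∪ ⁅ y ⁆ ∣
  x≢y⇒1<∣⁅x⁆∪⁅y⁆∣ {x} {y} x≢y = subst (_< ∣ ⁅ x ⁆ ∪ ⁅ y ⁆ ∣) (∣⁅x⁆∣≡1 x)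
    (p⊂q⇒∣p∣<∣q∣ (p⊆p∪q ⁅ y ⁆ , y , q⊆p∪q ⁅ x ⁆ ⁅ y ⁆ (x∈⁅x⁆ y) , x≢y⇒x∉⁅y⁆ (x≢y ∘ ≡.sym)))

  agree⇒∩≡ : ∀ {A B S : Subset n} → B ⊆ S → (∀ {i} → i ∈ S → lookup A i ≡ lookup B i) →
             A ∩ S ≡ B
  agree⇒∩≡ {A} {B} {S} B⊆S agree = ⊆-antisym A∩S⊆B B⊆A∩S
    where
    A∩S⊆B : A ∩ S ⊆ B
    A∩S⊆B {i} i∈A∩S with x∈p∩q⁻ A S i∈A∩S
    ... | i∈A , i∈S = lookup⇒[]= i B (trans (≡.sym (agree i∈S)) ([]=⇒lookup i∈A))
    B⊆A∩S : B ⊆ A ∩ S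
    B⊆A∩S {i} i∈B = x∈p∩q⁺ (lookup⇒[]= i A (trans (agree (B⊆S i∈B)) ([]=⇒lookup i∈B)) , B⊆S i∈B)

module _ {n : ℕ} (G : Graph n) where

  private
    variable
      a h α : ℕ
      v x y : Fin n
      I J W : Subset n

  infix 4 _~_ _≁_
  _~_ _≁_ : Fin n → Fin n → Set
  u ~ v = adj G u v ≡ true
  u ≁ v = adj G u v ≡ false

  ~-sym : x ~ y → y ~ x
  ~-sym {x} {y} = trans (sym G y x)

  ≁-sym : x ≁ y → y ≁ x
  ≁-sym {x} {y} = trans (sym G y x)

  ≁⇒¬~ : x ≁ y → ¬ x ~ y
  ≁⇒¬~ x≁y x~y = not-¬ x~y x≁y

  ¬~⇒≁ : ¬ x ~ y → x ≁ y
  ¬~⇒≁ = ¬-not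

  ~⇒≢ : x ~ y → x ≢ y
  ~⇒≢ {x} x~y refl = ≁⇒¬~ (irrefl G x) x~y

  ∈N⇒~ : x ∈ N G v → v ~ x
  ∈N⇒~ {x} {v} x∈Nv = trans (≡.sym (lookup∘tabulate (adj G v) x)) ([]=⇒lookup x∈Nv)

  ~⇒∈N : v ~ x → x ∈ N G v
  ~⇒∈N {v} {x} v~x = lookup⇒[]= x (N G v) (trans (lookup∘tabulate (adj G v) x) v~x)

  N∁ : Fin n → Subset n
  N∁ v = ∁ (N G v)

  ≁⇒∈N∁ : v ≁ x → x ∈ N∁ v
  ≁⇒∈N∁ v≁x = x∉p⇒x∈∁p (≁⇒¬~ v≁x ∘ ∈N⇒~)

  ∈N∁⇒≁ : x ∈ N∁ v → v ≁ x
  ∈N∁⇒≁ x∈N∁v = ¬~⇒≁ (x∈∁p⇒x∉p x∈N∁v ∘ ~⇒∈N)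

  Independent-∪⁅⁆ : Independent G J → (∀ s → s ∈ J → v ≁ s) → Independent G (J ∪ ⁅ v ⁆)
  Independent-∪⁅⁆ {J} {u} J-ind u≁J x y x∈ y∈ with x∈p∪q⁻ J ⁅ u ⁆ x∈ | x∈p∪q⁻ J ⁅ u ⁆ y∈
  ... | inj₁ x∈J | inj₁ y∈J = J-ind x y x∈J y∈J
  ... | inj₁ x∈J | inj₂ y∈⁅u⁆ rewrite x∈⁅y⁆⇒x≡y u y∈⁅u⁆ = ≁-sym (u≁J x x∈J)
  ... | inj₂ x∈⁅u⁆ | inj₁ y∈J rewrite x∈⁅y⁆⇒x≡y u x∈⁅u⁆ = u≁J y y∈J
  ... | inj₂ x∈⁅u⁆ | inj₂ y∈⁅u⁆
    rewrite x∈⁅y⁆⇒x≡y u x∈⁅u⁆ | x∈⁅y⁆⇒x≡y u y∈⁅u⁆ = irrefl G u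

  -- For α = 0 the empty set is a maximum independent set, and no set meets it.
  hittingNumber⇒0<α : IsHittingNumber G a h → 0 < a
  hittingNumber⇒0<α {zero} ((T , T-hits , _) , _)
    with T-hits ⊥ ((λ _ _ x∈⊥ _ → ⊥-elim (∉⊥ x∈⊥)) , ∣⊥∣≡0 n)
  ... | x , x∈T∩⊥ = ⊥-elim (∉⊥ (proj₂ (x∈p∩q⁻ T ⊥ x∈T∩⊥)))
  hittingNumber⇒0<α {suc a} _ = z<s

  Triangle : Set
  Triangle = ∃ λ x → ∃ λ y → ∃ λ z → x ~ y × y ~ z × x ~ z

  triangle? : Dec Triangle
  triangle? = any? λ x → any? λ y → any? λ z →
    (adj G x y ≟ true) ×-dec (adj G y z ≟ true) ×-dec (adj G x z ≟ true)

  PairShattered : Fin n → Fin n → Set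
  PairShattered x y = ∀ b c → ∃ λ v → adj G v x ≡ b × adj G v y ≡ c

  NoShatteredPair : Set
  NoShatteredPair = ∀ {x y} → x ≢ y → ¬ PairShattered x y

  vcDim1⇒noShatteredPair : HasVCdim G 1 → NoShatteredPair
  vcDim1⇒noShatteredPair (_ , ∣S∣≤1) {x} {y} x≢y shattered =
    <⇒≱ (x≢y⇒1<∣⁅x⁆∪⁅y⁆∣ x≢y) (∣S∣≤1 S S-shattered)
    where
    S : Subset n
    S = ⁅ x ⁆ ∪ ⁅ y ⁆
    S-shattered : Shattered G S
    S-shattered B B⊆S with shattered (lookup B x) (lookup B y)
    ... | v , v-x , v-y = v , agree⇒∩≡ B⊆S agree
      where
      agree : ∀ {i} → i ∈ S → lookup (N G v) i ≡ lookup B i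
      agree i∈S with x∈p∪q⁻ ⁅ x ⁆ ⁅ y ⁆ i∈S
      ... | inj₁ i∈⁅x⁆ rewrite x∈⁅y⁆⇒x≡y x i∈⁅x⁆ = trans (lookup∘tabulate (adj G v) x) v-x
      ... | inj₂ i∈⁅y⁆ rewrite x∈⁅y⁆⇒x≡y y i∈⁅y⁆ = trans (lookup∘tabulate (adj G v) y) v-y

  -- Non-adjacency, which is reflexive and symmetric, is transitive: the parts are the N∁ v.
  CompleteMultipartite : Set
  CompleteMultipartite = ∀ {v x y} → v ≁ x → v ≁ y → x ≁ y

  module _ (noShatter : NoShatteredPair) where

    commonNeighbour⇒dominating : ∀ {x y w} → x ~ y → w ~ x → w ~ y → ∀ z → z ~ x ⊎ z ~ y
    commonNeighbour⇒dominating {x} {y} {w} x~y w~x w~y z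
      with adj G z x in z-x | adj G z y in z-y
    ... | true  | _     = inj₁ refl
    ... | false | true  = inj₂ refl
    ... | false | false = ⊥-elim (noShatter (~⇒≢ x~y) λ
      { true  true  → w , w~x , w~y
      ; true  false → y , ~-sym x~y , irrefl G y
      ; false true  → x , irrefl G x , x~y
      ; false false → z , z-x , z-y })

    triangle⇒commonNeighbours : Triangle → ∀ p q → ∃ λ w → w ~ p × w ~ q
    triangle⇒commonNeighbours (a , b , c , a~b , b~c , a~c) = common
      where
      b-and-c : ∀ {z} → z ≁ a → z ~ b × z ~ c
      b-and-c {z} z≁a =
          [ ⊥-elim ∘ ≁⇒¬~ z≁a , id ] (commonNeighbour⇒dominating a~b (~-sym a~c) (~-sym b~c) z)
        , [ ⊥-elim ∘ ≁⇒¬~ z≁a , id ] (commonNeighbour⇒dominating a~c (~-sym a~b) b~c z)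
      commonWith : ∀ {z} → z ~ b × z ~ c → ∀ y → ∃ λ w → w ~ z × w ~ y
      commonWith (z~b , z~c) y with commonNeighbour⇒dominating b~c a~b a~c y
      ... | inj₁ y~b = b , ~-sym z~b , ~-sym y~b
      ... | inj₂ y~c = c , ~-sym z~c , ~-sym y~c
      common : ∀ p q → ∃ λ w → w ~ p × w ~ q
      common p q with adj G a p in a-p | adj G a q in a-q
      ... | true  | true  = a , a-p , a-q
      ... | false | _     = commonWith (b-and-c (≁-sym a-p)) q
      ... | true  | false = map₂ swap (commonWith (b-and-c (≁-sym a-q)) p)

    commonNeighbours⇒completeMultipartite :
      (∀ p q → ∃ λ w → w ~ p × w ~ q) → CompleteMultipartite
    commonNeighbours⇒completeMultipartite common {v} {x} {y} v≁x v≁y = ¬~⇒≁ λ x~y →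
      let w , w~x , w~y = common x y
      in [ ≁⇒¬~ v≁x , ≁⇒¬~ v≁y ] (commonNeighbour⇒dominating x~y w~x w~y v)

  module _ (multipartite : CompleteMultipartite) where

    ClosedUnderParts : Subset n → Set
    ClosedUnderParts W = ∀ {v x} → v ∈ W → x ∈ N∁ v → x ∈ W

    ─N∁-closedUnderParts : ClosedUnderParts W → ClosedUnderParts (W ─ N∁ v)
    ─N∁-closedUnderParts {W} {v} closed {v′} {x} v′∈W′ x∈N∁v′ =
      x∈p∧x∉q⇒x∈p─q (closed (p─q⊆p W (N∁ v) v′∈W′) x∈N∁v′) x∉N∁v
      where
      x∉N∁v : x ∉ N∁ v
      x∉N∁v x∈N∁v = x∈p─q⇒x∉q W (N∁ v) v′∈W′
        (≁⇒∈N∁ (multipartite (≁-sym (∈N∁⇒≁ x∈N∁v)) (≁-sym (∈N∁⇒≁ x∈N∁v′))))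

    partRepresentatives : ∀ a k W → ∣ W ∣ ≤ k → ClosedUnderParts W →
      ∃ λ T → (∀ {v} → v ∈ W → ∣ N∁ v ∣ ≡ a → Nonempty (T ∩ N∁ v)) × ∣ T ∣ * a ≤ ∣ W ∣
    partRepresentatives a k W ∣W∣≤k closed with any? (λ v → (v ∈? W) ×-dec (∣ N∁ v ∣ ≟ℕ a))
    ... | no ∄v = ⊥ , (λ v∈W ∣N∁v∣≡a → ⊥-elim (∄v (_ , v∈W , ∣N∁v∣≡a)))
                    , subst (λ t → t * a ≤ ∣ W ∣) (≡.sym (∣⊥∣≡0 n)) z≤n
    partRepresentatives a zero W ∣W∣≤0 closed | yes (v , v∈W , _) =
      ⊥-elim (<⇒≱ (≤-trans (s≤s z≤n) (x∈p⇒∣p-x∣<∣p∣ v∈W)) ∣W∣≤0)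
    partRepresentatives a (suc k) W ∣W∣≤1+k closed | yes (v , v∈W , ∣N∁v∣≡a) =
      T′ ∪ ⁅ v ⁆ , hits , size
      where
      W′ = W ─ N∁ v
      v∈N∁v : v ∈ N∁ v
      v∈N∁v = ≁⇒∈N∁ (irrefl G v)
      ∣W′∣<∣W∣ : ∣ W′ ∣ < ∣ W ∣
      ∣W′∣<∣W∣ = p∩q≢∅⇒∣p─q∣<∣p∣ W (N∁ v) (v , x∈p∩q⁺ (v∈W , v∈N∁v))
      reps = partRepresentatives a k W′ (≤-pred (≤-trans ∣W′∣<∣W∣ ∣W∣≤1+k))
                                 (─N∁-closedUnderParts closed)
      T′ = proj₁ reps
      hits : ∀ {v′} → v′ ∈ W → ∣ N∁ v′ ∣ ≡ a → Nonempty ((T′ ∪ ⁅ v ⁆) ∩ N∁ v′)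
      hits {v′} v′∈W ∣N∁v′∣≡a with v′ ∈? N∁ v
      ... | yes v′∈N∁v =
        v , x∈p∩q⁺ (q⊆p∪q T′ ⁅ v ⁆ (x∈⁅x⁆ v) , ≁⇒∈N∁ (≁-sym (∈N∁⇒≁ v′∈N∁v)))
      ... | no v′∉N∁v =
        let t , t∈T′∩N∁v′ = proj₁ (proj₂ reps) (x∈p∧x∉q⇒x∈p─q v′∈W v′∉N∁v) ∣N∁v′∣≡a
            t∈T′ , t∈N∁v′ = x∈p∩q⁻ T′ (N∁ v′) t∈T′∩N∁v′
        in t , x∈p∩q⁺ (p⊆p∪q ⁅ v ⁆ t∈T′ , t∈N∁v′)
      size : ∣ T′ ∪ ⁅ v ⁆ ∣ * a ≤ ∣ W ∣
      size = begin
        ∣ T′ ∪ ⁅ v ⁆ ∣ * a      ≤⟨ *-monoˡ-≤ a (∣p∪q∣≤∣p∣+∣q∣ T′ ⁅ v ⁆) ⟩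
        (∣ T′ ∣ + ∣ ⁅ v ⁆ ∣) * a  ≡⟨ cong (λ t → (∣ T′ ∣ + t) * a) (∣⁅x⁆∣≡1 v) ⟩
        (∣ T′ ∣ + 1) * a         ≡⟨ *-distribʳ-+ a ∣ T′ ∣ 1 ⟩
        ∣ T′ ∣ * a + 1 * a       ≤⟨ +-mono-≤ (proj₂ (proj₂ reps))
                                     (≤-reflexive (trans (*-identityˡ a) (≡.sym ∣N∁v∣≡a))) ⟩
        ∣ W′ ∣ + ∣ N∁ v ∣        ≡⟨ ≡.sym (q⊆p⇒∣p∣≡∣p─q∣+∣q∣ (closed v∈W)) ⟩
        ∣ W ∣                    ∎
        where open ≤-Reasoning

    maximumIndependent⇒part : (∀ S → Independent G S → ∣ S ∣ ≤ a) → IsMaxIndependent G a I →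
                              x ∈ I → N∁ x ⊆ I × ∣ N∁ x ∣ ≡ a
    maximumIndependent⇒part {a} {I} {x} α-max (I-ind , ∣I∣≡a) x∈I =
      p⊆q∧∣q∣≤∣p∣⇒q⊆p I⊆N∁x (subst (∣ N∁ x ∣ ≤_) (≡.sym ∣I∣≡a) ∣N∁x∣≤a) ,
      ≤-antisym ∣N∁x∣≤a (subst (_≤ ∣ N∁ x ∣) ∣I∣≡a (p⊆q⇒∣p∣≤∣q∣ I⊆N∁x))
      where
      I⊆N∁x : I ⊆ N∁ x
      I⊆N∁x y∈I = ≁⇒∈N∁ (I-ind x _ x∈I y∈I)
      ∣N∁x∣≤a : ∣ N∁ x ∣ ≤ a
      ∣N∁x∣≤a = α-max (N∁ x) λ y z y∈ z∈ → multipartite (∈N∁⇒≁ y∈) (∈N∁⇒≁ z∈)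

    completeMultipartite⇒h*α≤n : IsIndependenceNumber G a → IsHittingNumber G a h → h * a ≤ n
    completeMultipartite⇒h*α≤n {a} {h} (_ , α-max) h-G@(_ , h-min) = begin
      h * a      ≤⟨ *-monoˡ-≤ a (h-min T T-hits) ⟩
      ∣ T ∣ * a  ≤⟨ proj₂ (proj₂ reps) ⟩
      ∣ ⊤ {n} ∣  ≡⟨ ∣⊤∣≡n n ⟩
      n          ∎
      where
      open ≤-Reasoning
      reps = partRepresentatives a n ⊤ (∣p∣≤n ⊤) (λ _ _ → ∈⊤)
      T = proj₁ reps
      T-hits : IsHittingSet G a T
      T-hits S S-max
        with 0<∣p∣⇒Nonempty (subst (0 <_) (≡.sym (proj₂ S-max)) (hittingNumber⇒0<α h-G))
      ... | x , x∈S =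
        let N∁x⊆S , ∣N∁x∣≡a = maximumIndependent⇒part α-max S-max x∈S
            t , t∈T∩N∁x = proj₁ (proj₂ reps) ∈⊤ ∣N∁x∣≡a
            t∈T , t∈N∁x = x∈p∩q⁻ T (N∁ x) t∈T∩N∁x
        in t , x∈p∩q⁺ (t∈T , N∁x⊆S t∈N∁x)

  IndependentIn : Subset n → Subset n → Set
  IndependentIn W I = I ⊆ W × Independent G I

  IndependentIn-mono : ∀ {V} → V ⊆ W → IndependentIn V I → IndependentIn W I
  IndependentIn-mono V⊆W (I⊆V , I-ind) = ⊆-trans I⊆V V⊆W , I-ind

  MaximumIndependentIn : Subset n → ℕ → Subset n → Set
  MaximumIndependentIn W α I = IndependentIn W I × ∣ I ∣ ≡ α

  IndependenceBound : Subset n → ℕ → Set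
  IndependenceBound W α = ∀ I → IndependentIn W I → ∣ I ∣ ≤ α

  IsIndependenceNumberIn : Subset n → ℕ → Set
  IsIndependenceNumberIn W α = (∃ λ I → MaximumIndependentIn W α I) × IndependenceBound W α

  InCore : Subset n → ℕ → Fin n → Set
  InCore W α x = ∀ I → MaximumIndependentIn W α I → x ∈ I

  degreeIn : Subset n → Fin n → ℕ
  degreeIn W v = ∣ N G v ∩ W ∣

  maximumIndependent⇒In⊤ : IsMaxIndependent G a I → MaximumIndependentIn ⊤ a I
  maximumIndependent⇒In⊤ (I-ind , ∣I∣≡a) = ((λ _ → ∈⊤) , I-ind) , ∣I∣≡a

  independenceNumber⇒In⊤ : IsIndependenceNumber G a → IsIndependenceNumberIn ⊤ a
  independenceNumber⇒In⊤ ((I , I-max) , α-max) =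
    (I , maximumIndependent⇒In⊤ I-max) , λ J J-ind → α-max J (proj₂ J-ind)

  extension-bound : IndependenceBound W α → IndependentIn W J → x ∈ W → x ∉ J →
                    (∀ s → s ∈ J → x ≁ s) → suc ∣ J ∣ ≤ α
  extension-bound {W} {α} {J} {x} α-max (J⊆W , J-ind) x∈W x∉J x≁J = begin
    suc ∣ J ∣       ≤⟨ p⊂q⇒∣p∣<∣q∣ (p⊆p∪q ⁅ x ⁆ , x , x∈p∪q⁺ (inj₂ (x∈⁅x⁆ x)) , x∉J) ⟩
    ∣ J ∪ ⁅ x ⁆ ∣   ≤⟨ α-max (J ∪ ⁅ x ⁆) (J∪x⊆W , Independent-∪⁅⁆ J-ind x≁J) ⟩
    α               ∎
    where
    open ≤-Reasoning
    J∪x⊆W : J ∪ ⁅ x ⁆ ⊆ W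
    J∪x⊆W y∈ = [ J⊆W , (λ y∈⁅x⁆ → subst (_∈ W) (≡.sym (x∈⁅y⁆⇒x≡y x y∈⁅x⁆)) x∈W) ]
                 (x∈p∪q⁻ J ⁅ x ⁆ y∈)

  isolated⇒InCore : IndependenceBound W α → v ∈ W → (∀ s → s ∈ W → v ≁ s) → InCore W α v
  isolated⇒InCore {v = u} α-max u∈W u-isolated I (I-ind@(I⊆W , _) , ∣I∣≡α) with u ∈? I
  ... | yes u∈I = u∈I
  ... | no u∉I = ⊥-elim (<-irrefl ∣I∣≡α
        (extension-bound α-max I-ind u∈W u∉I (λ s s∈I → u-isolated s (I⊆W s∈I))))

  minimumDegreeIn : x ∈ W → ∃ λ u → u ∈ W × ∀ {v} → v ∈ W → degreeIn W u ≤ degreeIn W v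
  minimumDegreeIn {x} {W} x∈W =
    argmin (degreeIn W) x candidates ,
    argmin-all (degreeIn W) x∈W (all-filter (_∈? W) (allFin n)) ,
    λ {v} v∈W → All.lookup (f[argmin]≤f[xs] x candidates) (∈-filter⁺ (_∈? W) (∈-allFin v) v∈W)
    where
    candidates = filter (_∈? W) (allFin n)

  record MinimumDegreeEdge (W : Subset n) : Set where
    field
      u w       : Fin n
      u∈W       : u ∈ W
      w∈W       : w ∈ W
      u~w       : u ~ w
      u-minimum : ∀ {v} → v ∈ W → degreeIn W u ≤ degreeIn W v

  coreless⇒minimumDegreeEdge : IsIndependenceNumberIn W α → 0 < α → (∀ x → ¬ InCore W α x) →
                               MinimumDegreeEdge W
  coreless⇒minimumDegreeEdge {W} ((I , (I⊆W , _) , ∣I∣≡α) , α-max) 0<α coreless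
    with 0<∣p∣⇒Nonempty (subst (0 <_) (≡.sym ∣I∣≡α) 0<α)
  ... | x , x∈I with minimumDegreeIn (I⊆W x∈I)
  ...   | u , u∈W , u-min with any? (λ w → (w ∈? W) ×-dec (adj G u w ≟ true))
  ...     | yes (w , w∈W , u~w) = record
    { u = u ; w = w ; u∈W = u∈W ; w∈W = w∈W ; u~w = u~w ; u-minimum = u-min }
  ...     | no ∄w = ⊥-elim (coreless u (isolated⇒InCore α-max u∈W
                      λ s s∈W → ¬~⇒≁ λ u~s → ∄w (s , s∈W , u~s)))

  module _ (noShatter : NoShatteredPair) (triangleFree : ¬ Triangle) where

    commonNeighbour⇒nestedNeighbourhoods :
      ∀ {w u c s x} → w ~ u → w ~ c → u ≢ c → u ~ s → c ≁ s → c ~ x → u ~ x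
    commonNeighbour⇒nestedNeighbourhoods {w} {u} {c} {s} {x} w~u w~c u≢c u~s c≁s c~x
      with adj G u x in u-x
    ... | true  = refl
    ... | false = ⊥-elim (noShatter u≢c λ
      { true  true  → w , w~u , w~c
      ; true  false → s , ~-sym u~s , ≁-sym c≁s
      ; false true  → x , ≁-sym u-x , ~-sym c~x
      ; false false → c , c≁u , irrefl G c })
      where
      c≁u : c ≁ u
      c≁u = ¬~⇒≁ λ c~u → triangleFree (w , u , c , w~u , ~-sym c~u , w~c)

    module _ {W : Subset n} (E : MinimumDegreeEdge W) where
      open MinimumDegreeEdge E

      W⁻ : Subset n
      W⁻ = W - u - w

      W⁻⊆W : W⁻ ⊆ W
      W⁻⊆W = ⊆-trans (p─q⊆p (W - u) ⁅ w ⁆) (p─q⊆p W ⁅ u ⁆)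

      ∈W⁻⁺ : x ∈ W → x ≢ u → x ≢ w → x ∈ W⁻
      ∈W⁻⁺ x∈W x≢u x≢w = x∈p∧x≢y⇒x∈p-y (x∈p∧x≢y⇒x∈p-y x∈W x≢u) x≢w

      u∉W⁻ : u ∉ W⁻
      u∉W⁻ u∈W⁻ = x∈p-y⇒x≢y (p─q⊆p (W - u) ⁅ w ⁆ u∈W⁻) refl

      w∉W⁻ : w ∉ W⁻
      w∉W⁻ w∈W⁻ = x∈p-y⇒x≢y w∈W⁻ refl

      ∣W∣≡2+∣W⁻∣ : ∣ W ∣ ≡ 2 + ∣ W⁻ ∣
      ∣W∣≡2+∣W⁻∣ = trans (x∈p⇒∣p∣≡1+∣p-x∣ u∈W)
        (cong suc (x∈p⇒∣p∣≡1+∣p-x∣ (x∈p∧x≢y⇒x∈p-y w∈W (~⇒≢ u~w ∘ ≡.sym))))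

      -- Any other neighbour c of w has at least u's degree, so nestedness forces N u ∩ W ⊆ N c.
      N[u]∩W⊆N[c] : ∀ {c} → c ∈ W → c ~ w → c ≢ u → N G u ∩ W ⊆ N G c
      N[u]∩W⊆N[c] {c} c∈W c~w c≢u {s} s∈N[u]∩W with s ∈? N G c
      ... | yes s∈N[c] = s∈N[c]
      ... | no s∉N[c] = ⊥-elim (<⇒≱ deg[c]<deg[u] (u-minimum c∈W))
        where
        nested : ∀ {x} → c ~ x → u ~ x
        nested = commonNeighbour⇒nestedNeighbourhoods (~-sym u~w) (~-sym c~w) (c≢u ∘ ≡.sym)
                   (∈N⇒~ (proj₁ (x∈p∩q⁻ (N G u) W s∈N[u]∩W))) (¬~⇒≁ (s∉N[c] ∘ ~⇒∈N))
        N[c]∩W⊆N[u]∩W : N G c ∩ W ⊆ N G u ∩ W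
        N[c]∩W⊆N[u]∩W x∈ with x∈p∩q⁻ (N G c) W x∈
        ... | x∈N[c] , x∈W = x∈p∩q⁺ (~⇒∈N (nested (∈N⇒~ x∈N[c])) , x∈W)
        deg[c]<deg[u] : degreeIn W c < degreeIn W u
        deg[c]<deg[u] = p⊂q⇒∣p∣<∣q∣
          (N[c]∩W⊆N[u]∩W , s , s∈N[u]∩W , s∉N[c] ∘ proj₁ ∘ x∈p∩q⁻ (N G c) W)

      -- If both u and w had a neighbour in J, those neighbours would be adjacent.
      avoiding⇒extensible : IndependenceBound W α → IndependentIn W⁻ J → suc ∣ J ∣ ≤ α
      avoiding⇒extensible {J = J} α-max J-In@(J⊆W⁻ , J-ind)
        with any? (λ s → (s ∈? J) ×-dec (adj G u s ≟ true))
      ... | no ∄s = extension-bound α-max (IndependentIn-mono W⁻⊆W J-In) u∈W (u∉W⁻ ∘ J⊆W⁻)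
                      λ s s∈J → ¬~⇒≁ λ u~s → ∄s (s , s∈J , u~s)
      ... | yes (s , s∈J , u~s) with any? (λ c → (c ∈? J) ×-dec (adj G w c ≟ true))
      ...   | no ∄c = extension-bound α-max (IndependentIn-mono W⁻⊆W J-In) w∈W (w∉W⁻ ∘ J⊆W⁻)
                        λ c c∈J → ¬~⇒≁ λ w~c → ∄c (c , c∈J , w~c)
      ...   | yes (c , c∈J , w~c) = ⊥-elim (≁⇒¬~ (J-ind c s c∈J s∈J) (∈N⇒~ s∈N[c]))
        where
        s∈N[c] : s ∈ N G c
        s∈N[c] = N[u]∩W⊆N[c] (W⁻⊆W (J⊆W⁻ c∈J)) (~-sym w~c) (λ { refl → u∉W⁻ (J⊆W⁻ c∈J) })
                   (x∈p∩q⁺ (~⇒∈N u~s , W⁻⊆W (J⊆W⁻ s∈J)))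

      minimumDegreeEdge-hits : IndependenceBound W α → MaximumIndependentIn W α I → u ∈ I ⊎ w ∈ I
      minimumDegreeEdge-hits {I = I} α-max ((I⊆W , I-ind) , ∣I∣≡α) with u ∈? I | w ∈? I
      ... | yes u∈I | _       = inj₁ u∈I
      ... | no _    | yes w∈I = inj₂ w∈I
      ... | no u∉I  | no w∉I  = ⊥-elim (<-irrefl ∣I∣≡α (avoiding⇒extensible α-max (I⊆W⁻ , I-ind)))
        where
        I⊆W⁻ : I ⊆ W⁻
        I⊆W⁻ x∈I = ∈W⁻⁺ (I⊆W x∈I) (λ { refl → u∉I x∈I }) (λ { refl → w∉I x∈I })

      maximumIndependent-shrinks : IndependenceBound W (suc α) → MaximumIndependentIn W (suc α) I →
                                   MaximumIndependentIn W⁻ α (I - u - w)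
      maximumIndependent-shrinks {α} {I} α-max ((I⊆W , I-ind) , ∣I∣≡1+α) =
        I⁻-In , ≤-antisym (≤-pred (avoiding⇒extensible α-max I⁻-In))
                          (≤-pred (subst (_≤ suc ∣ I - u - w ∣) ∣I∣≡1+α (∣p∣≤1+∣p-x-y∣ u∈I⇒w∉I)))
        where
        u∈I⇒w∉I : u ∈ I → w ∉ I
        u∈I⇒w∉I u∈I w∈I = ≁⇒¬~ (I-ind u w u∈I w∈I) u~w
        I⁻⊆I : I - u - w ⊆ I
        I⁻⊆I = ⊆-trans (p─q⊆p (I - u) ⁅ w ⁆) (p─q⊆p I ⁅ u ⁆)
        I⁻-In : IndependentIn W⁻ (I - u - w)
        I⁻-In = p⊆q⇒p-x⊆q-x (p⊆q⇒p-x⊆q-x I⊆W)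
              , λ x y x∈ y∈ → I-ind x y (I⁻⊆I x∈) (I⁻⊆I y∈)

      independenceNumber-drops : IsIndependenceNumberIn W (suc α) → IsIndependenceNumberIn W⁻ α
      independenceNumber-drops ((I , I-max) , α-max) =
        (I - u - w , maximumIndependent-shrinks α-max I-max) ,
        λ J J-In → ≤-pred (avoiding⇒extensible α-max J-In)

      InCore-lifts : IndependenceBound W (suc α) → InCore W⁻ α x → InCore W (suc α) x
      InCore-lifts α-max x-core I I-max =
        p─q⊆p I ⁅ u ⁆ (p─q⊆p (I - u) ⁅ w ⁆ (x-core _ (maximumIndependent-shrinks α-max I-max)))

    coreless⇒2α≤∣W∣ : ∀ α → IsIndependenceNumberIn W α → (∀ x → ¬ InCore W α x) → 2 * α ≤ ∣ W ∣
    coreless⇒2α≤∣W∣ zero _ _ = z≤n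
    coreless⇒2α≤∣W∣ {W} (suc α) α-W@(_ , α-max) coreless = begin
      2 * suc α      ≡⟨ *-suc 2 α ⟩
      2 + 2 * α      ≤⟨ +-monoʳ-≤ 2 (coreless⇒2α≤∣W∣ α (independenceNumber-drops E α-W)
                                       λ x → coreless x ∘ InCore-lifts E α-max) ⟩
      2 + ∣ W⁻ E ∣   ≡⟨ ≡.sym (∣W∣≡2+∣W⁻∣ E) ⟩
      ∣ W ∣          ∎
      where
      open ≤-Reasoning
      E = coreless⇒minimumDegreeEdge α-W z<s coreless

    triangleFree⇒h*α≤n : IsIndependenceNumber G a → IsHittingNumber G a h → h * a ≤ n
    triangleFree⇒h*α≤n {a} {h} α-G@((S , _ , ∣S∣≡a) , _) h-G@(_ , h-min) with h ≤? 1
    ... | yes h≤1 = begin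
      h * a  ≤⟨ *-monoˡ-≤ a h≤1 ⟩
      1 * a  ≡⟨ *-identityˡ a ⟩
      a      ≡⟨ ≡.sym ∣S∣≡a ⟩
      ∣ S ∣  ≤⟨ ∣p∣≤n S ⟩
      n      ∎
      where open ≤-Reasoning
    ... | no h≰1 = begin
      h * a        ≤⟨ *-monoˡ-≤ a h≤2 ⟩
      2 * a        ≤⟨ coreless⇒2α≤∣W∣ a α-⊤ coreless ⟩
      ∣ ⊤ {n} ∣    ≡⟨ ∣⊤∣≡n n ⟩
      n            ∎
      where
      open ≤-Reasoning
      α-⊤ = independenceNumber⇒In⊤ α-G
      coreless : ∀ x → ¬ InCore ⊤ a x
      coreless x x-core = h≰1 (subst (h ≤_) (∣⁅x⁆∣≡1 x) (h-min ⁅ x ⁆ λ S S-max →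
        x , x∈p∩q⁺ (x∈⁅x⁆ x , x-core S (maximumIndependent⇒In⊤ S-max))))
      E = coreless⇒minimumDegreeEdge α-⊤ (hittingNumber⇒0<α h-G) coreless
      open MinimumDegreeEdge E
      uw-hits : IsHittingSet G a (⁅ u ⁆ ∪ ⁅ w ⁆)
      uw-hits S S-max with minimumDegreeEdge-hits E (proj₂ α-⊤) (maximumIndependent⇒In⊤ S-max)
      ... | inj₁ u∈S = u , x∈p∩q⁺ (p⊆p∪q ⁅ w ⁆ (x∈⁅x⁆ u) , u∈S)
      ... | inj₂ w∈S = w , x∈p∩q⁺ (q⊆p∪q ⁅ u ⁆ ⁅ w ⁆ (x∈⁅x⁆ w) , w∈S)
      h≤2 : h ≤ 2
      h≤2 = begin
        h                          ≤⟨ h-min _ uw-hits ⟩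
        ∣ ⁅ u ⁆ ∪ ⁅ w ⁆ ∣           ≤⟨ ∣p∪q∣≤∣p∣+∣q∣ ⁅ u ⁆ ⁅ w ⁆ ⟩
        ∣ ⁅ u ⁆ ∣ + ∣ ⁅ w ⁆ ∣       ≡⟨ cong₂ _+_ (∣⁅x⁆∣≡1 u) (∣⁅x⁆∣≡1 w) ⟩
        2                          ∎

h*a≤n∧5a≡2n⇒h≤3 : ∀ {h a n} → 0 < a → h * a ≤ n → 5 * a ≡ 2 * n → h ≤ 3
h*a≤n∧5a≡2n⇒h≤3 {h} {a} {n} 0<a h*a≤n 5a≡2n = *-cancelˡ-≤ 2 (≤-trans 2h≤5 (n≤1+n 5))
  where
  open ≤-Reasoning
  2h≤5 : 2 * h ≤ 5
  2h≤5 = *-cancelʳ-≤ (2 * h) 5 a {{>-nonZero 0<a}} (begin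
    2 * h * a    ≡⟨ *-assoc 2 h a ⟩
    2 * (h * a)  ≤⟨ *-monoʳ-≤ 2 h*a≤n ⟩
    2 * n        ≡⟨ ≡.sym 5a≡2n ⟩
    5 * a        ∎)

theorem1p7 : ∀ (n : ℕ) (G : Graph n) (a h : ℕ) →
    HasVCdim G 1 → IsIndependenceNumber G a → IsHittingNumber G a h →
    (h * a ≤ n ⊎ h ≤ 3)
    × (5 * a ≢ 2 * n → h * a ≤ n)
    × (5 * a ≡ 2 * n → h ≤ 3)
theorem1p7 n G a h vcDim1 α-G h-G =
  inj₁ h*a≤n , (λ _ → h*a≤n) , h*a≤n∧5a≡2n⇒h≤3 (hittingNumber⇒0<α G h-G) h*a≤n
  where
  noShatter = vcDim1⇒noShatteredPair G vcDim1
  h*a≤n : h * a ≤ n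
  h*a≤n with triangle? G
  ... | yes triangle = completeMultipartite⇒h*α≤n G
          (commonNeighbours⇒completeMultipartite G noShatter
            (triangle⇒commonNeighbours G noShatter triangle)) α-G h-G
  ... | no triangleFree = triangleFree⇒h*α≤n G noShatter triangleFree α-G h-G
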